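{- (1) $Bip^-(\mathcal{DML})=V(\mathbf{A}_5)$; (2) $R(Bip^-(\mathcal{DML}))=V(\mathbf{A}_5,\mathbf{IS}_2)$; (3) $B^-(\mathcal{DML})=V(\mathbf{A}_5,\mathbf{IS}_4)$.
   Context: All algebras have type $\langle 2,2,1\rangle$ ($\land,\lor,\lnot$). $\mathcal{DML}$ is the variety of De Morgan lattices (distributive lattices with $\lnot\lnot x\approx x$, $\lnot(x\land y)\approx\lnot x\lor\lnot y$, $\lnot(x\lor y)\approx\lnot x\land\lnot y$). Involutive semilattices (semilattices $\langle I,\lor\rangle$ with $\lnot\lnot x\approx x$, $\lnot(x\lor y)\approx\lnot x\lor\lnot y$) are viewed as type $\langle 2,2,1\rangle$ with $x\land y:=x\lor y$. $\mathbf{IS}_2=\{\mathbf{i}<\mathbf{j}\}$ with $\lnot$ identity. $\mathbf{IS}_4=\{\mathbf{i},\mathbf{j},\lnot\mathbf{j},\mathbf{k}\}$ with $\mathbf{i}$ bottom, $\mathbf{k}$ top, $\mathbf{j}\lor\lnot\mathbf{j}=\mathbf{k}$, $\lnot\mathbf{i}=\mathbf{i}$, $\lnot\mathbf{k}=\mathbf{k}$. $\mathbf{A}_5$ is the algebra with universe $\{a,b,a',b',u\}$ where $\{a,b\}$ is a 2-element lattice with $b<a$; $\{a',b'\}$ a 2-element lattice with $a'<b'$; $\lnot$ swaps $a\leftrightarrow a'$, $b\leftrightarrow b'$ and fixes $u$; and $x\land y=x\lor y=u$ whenever $x,y$ do not both lie in $\{a,b\}$ or both in $\{a',b'\}$.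 For a term $\varphi$, $Var(\varphi)$ is its set of variables and $Var^{+}(\varphi)$ (resp. $Var^-(\varphi)$) the set of variables occurring in the scope of an even (resp. odd) number of $\lnot$'s. An identity $\varphi\approx\psi$ is regular if $Var(\varphi)=Var(\psi)$; balanced regular if $Var^\pm(\varphi)=Var^\pm(\psi)$; bipolar if $Var^+(\varphi)\cap Var^-(\varphi)\ne\emptyset$ and $Var^+(\psi)\cap Var^-(\psi)\ne\emptyset$; bipolarly balanced if bipolar or balanced regular; regular bipolarly balanced if bipolar and regular, or balanced regular. For a variety $\mathcal{V}$: $Bip^-(\mathcal{V})$ is the variety satisfying all and only the bipolarly balanced identities that are either valid in $\mathcal{V}$ or bipolar; $R(Bip^-(\mathcal{V}))$ is the variety satisfying all and only the regular bipolarly balanced identities that are either valid in $\mathcal{V}$ or bipolar; $B^-(\mathcal{V})$ is the variety satisfying all and only the balanced regular identities that are either valid in $\mathcal{V}$ or bipolar. $V(\mathcal{K})$ is the variety generated by $\mathcal{K}$. -}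

module Defs where

open import Level using (Level; Lift) renaming (suc to lsuc; zero to lzero)
open import Data.Nat using (ℕ)
open import Data.Bool using (Bool; true; false; not)
open import Data.Product using (_×_; _,_; ∃)
open import Data.Sum using (_⊎_)
open import Relation.Binary.PropositionalEquality using (_≡_)
open import Function.Bundles using (_⇔_)

record Alg : Set₁ where
  field
    Carrier : Set
    _⊓_ : Carrier → Carrier → Carrier
    _⊔'_ : Carrier → Carrier → Carrier
    ∼_ : Carrier → Carrier

infixr 6 _∧ₜ_
infixr 5 _∨ₜ_
data Term : Set where
  var  : ℕ → Term
  _∧ₜ_ : Term → Term → Term
  _∨ₜ_ : Term → Term → Term
  ¬ₜ_  : Term → Term

eval : (A : Alg) → (ℕ → Alg.Carrier A) → Term → Alg.Carrier A
eval A ρ (var x)   = ρ x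
eval A ρ (t ∧ₜ s)  = Alg._⊓_ A (eval A ρ t) (eval A ρ s)
eval A ρ (t ∨ₜ s)  = Alg._⊔'_ A (eval A ρ t) (eval A ρ s)
eval A ρ (¬ₜ t)    = Alg.∼_ A (eval A ρ t)

_⊨_≈_ : Alg → Term → Term → Set
A ⊨ φ ≈ ψ = (ρ : ℕ → Alg.Carrier A) → eval A ρ φ ≡ eval A ρ ψ

Identities : Set₂
Identities = Term → Term → Set₁

Mod : Identities → Alg → Set₁
Mod Σ A = ∀ φ ψ → Σ φ ψ → A ⊨ φ ≈ ψ

Id : (Alg → Set₁) → Identities
Id K φ ψ = ∀ A → K A → A ⊨ φ ≈ ψ

-- V(K) : the variety generated by K  (= Mod (Id K), Birkhoff)
V : (Alg → Set₁) → Alg → Set₁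
V K = Mod (Id K)

_≐_ : (Alg → Set₁) → (Alg → Set₁) → Set₁
K ≐ L = ∀ A → K A ⇔ L A

record IsDML (A : Alg) : Set where
  open Alg A
  field
    ∧-comm   : ∀ x y → (x ⊓ y) ≡ (y ⊓ x)
    ∨-comm   : ∀ x y → (x ⊔' y) ≡ (y ⊔' x)
    ∧-assoc  : ∀ x y z → ((x ⊓ y) ⊓ z) ≡ (x ⊓ (y ⊓ z))
    ∨-assoc  : ∀ x y z → ((x ⊔' y) ⊔' z) ≡ (x ⊔' (y ⊔' z))
    ∧-absorb : ∀ x y → (x ⊓ (x ⊔' y)) ≡ x
    ∨-absorb : ∀ x y → (x ⊔' (x ⊓ y)) ≡ x
    distrib  : ∀ x y z → (x ⊓ (y ⊔' z)) ≡ ((x ⊓ y) ⊔' (x ⊓ z))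
    dneg     : ∀ x → (∼ (∼ x)) ≡ x
    dm-∧     : ∀ x y → (∼ (x ⊓ y)) ≡ ((∼ x) ⊔' (∼ y))
    dm-∨     : ∀ x y → (∼ (x ⊔' y)) ≡ ((∼ x) ⊓ (∼ y))

DML : Alg → Set₁
DML A = Lift (lsuc lzero) (IsDML A)

occ : Bool → ℕ → Term → Set
occ p x (var y)  = (p ≡ true) × (x ≡ y)
occ p x (t ∧ₜ s) = occ p x t ⊎ occ p x s
occ p x (t ∨ₜ s) = occ p x t ⊎ occ p x s
occ p x (¬ₜ t)   = occ (not p) x t

Var⁺ Var⁻ Var : Term → ℕ → Set
Var⁺ t x = occ true x t
Var⁻ t x = occ false x t
Var t x = Var⁺ t x ⊎ Var⁻ t x

Regular : Term → Term → Set
Regular φ ψ = ∀ x → Var φ x ⇔ Var ψ x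

BalancedRegular : Term → Term → Set
BalancedRegular φ ψ = (∀ x → Var⁺ φ x ⇔ Var⁺ ψ x) × (∀ x → Var⁻ φ x ⇔ Var⁻ ψ x)

Bipolar : Term → Term → Set
Bipolar φ ψ = (∃ λ x → Var⁺ φ x × Var⁻ φ x) × (∃ λ y → Var⁺ ψ y × Var⁻ ψ y)

BipolarlyBalanced : Term → Term → Set
BipolarlyBalanced φ ψ = Bipolar φ ψ ⊎ BalancedRegular φ ψ

RegularBipolarlyBalanced : Term → Term → Set
RegularBipolarlyBalanced φ ψ = (Bipolar φ ψ × Regular φ ψ) ⊎ BalancedRegular φ ψ

ValidOrBipolar : (Alg → Set₁) → Identities
ValidOrBipolar 𝒱 φ ψ = Id 𝒱 φ ψ ⊎ Lift (lsuc lzero) (Bipolar φ ψ)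


Bip⁻ : (Alg → Set₁) → Alg → Set₁
Bip⁻ 𝒱 = Mod (λ φ ψ → Lift (lsuc lzero) (BipolarlyBalanced φ ψ) × ValidOrBipolar 𝒱 φ ψ)

RBip⁻ : (Alg → Set₁) → Alg → Set₁
RBip⁻ 𝒱 = Mod (λ φ ψ → Lift (lsuc lzero) (RegularBipolarlyBalanced φ ψ) × ValidOrBipolar 𝒱 φ ψ)

B⁻ : (Alg → Set₁) → Alg → Set₁
B⁻ 𝒱 = Mod (λ φ ψ → Lift (lsuc lzero) (BalancedRegular φ ψ) × ValidOrBipolar 𝒱 φ ψ)

data IS2C : Set where i j : IS2C

is2-join : IS2C → IS2C → IS2C
is2-join i y = y
is2-join j _ = j

IS₂ : Alg
IS₂ = record { Carrier = IS2C ; _⊓_ = is2-join ; _⊔'_ = is2-join ; ∼_ = λ x → x }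

data IS4C : Set where i j nj k : IS4C

is4-join : IS4C → IS4C → IS4C
is4-join i y   = y
is4-join k _   = k
is4-join j i   = j
is4-join j j   = j
is4-join j nj  = k
is4-join j k   = k
is4-join nj i  = nj
is4-join nj j  = k
is4-join nj nj = nj
is4-join nj k  = k

is4-neg : IS4C → IS4C
is4-neg i  = i
is4-neg j  = nj
is4-neg nj = j
is4-neg k  = k

IS₄ : Alg
IS₄ = record { Carrier = IS4C ; _⊓_ = is4-join ; _⊔'_ = is4-join ; ∼_ = is4-neg }

data A5C : Set where a b a' b' u : A5C

a5-meet : A5C → A5C → A5C
a5-meet a  a  = a
a5-meet a  b  = b
a5-meet b  a  = b
a5-meet b  b  = b
a5-meet a' a' = a'
a5-meet a' b' = a'
a5-meet b' a' = a'
a5-meet b' b' = b'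
a5-meet _  _  = u

a5-join : A5C → A5C → A5C
a5-join a  a  = a
a5-join a  b  = a
a5-join b  a  = a
a5-join b  b  = b
a5-join a' a' = a'
a5-join a' b' = b'
a5-join b' a' = b'
a5-join b' b' = b'
a5-join _  _  = u

a5-neg : A5C → A5C
a5-neg a  = a'
a5-neg b  = b'
a5-neg a' = a
a5-neg b' = b
a5-neg u  = u

A₅ : Alg
A₅ = record { Carrier = A5C ; _⊓_ = a5-meet ; _⊔'_ = a5-join ; ∼_ = a5-neg }

-- Finite classes of algebras: "A is (literally) one of the listed algebras"

⟦_⟧ : Alg → Alg → Set₁
⟦ B ⟧ A = Lift (lsuc lzero) (A ≡ B)

⟦_,_⟧ : Alg → Alg → Alg → Set₁
⟦ B , C ⟧ A = Lift (lsuc lzero) (A ≡ B ⊎ A ≡ C)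

-- An identity holds in IS₂ iff it is regular and in IS₄ iff it is balanced regular: both algebras
-- evaluate a term to the join of its literals, IS₂ forgetting their signs and IS₄ keeping them.
-- In A₅ a term in which some variable occurs with both polarities always evaluates to u. A term
-- without such a variable evaluates into one of the two-element lattices b < a, a' < b' exactly when
-- all its literals lie in it, and there it computes its negation normal form with the literals as
-- independent Boolean variables. Hence A₅ satisfies φ ≈ ψ iff both sides are bipolar, or φ ≈ ψ is
-- balanced and valid in the four-element De Morgan lattice M₄; by the disjunctive normal form
-- argument the latter means valid in all De Morgan lattices. So each of the three varieties is
-- axiomatised by exactly the identities valid in its generators.
module Submission where

open import Data.Product using (_×_; _,′_)
open import Defs

-- With Data.Product's _,_ in scope, ⟦ A₅ , IS₂ ⟧ would also parse as ⟦ (A₅ , IS₂) ⟧.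
module Proof where

  open import Level using (lift) renaming (zero to 0ℓ)
  open import Algebra.Lattice.Bundles using (Lattice)
  import Algebra.Lattice.Properties.Lattice as LatticeProperties
  import Relation.Binary.Lattice.Bundles as OrderTheoretic
  open import Data.Bool using (Bool; true; false; not; T; _∧_; _∨_)
  import Data.Bool.Properties as Boolₚ
  open import Data.Bool.Properties using (not-involutive; not-¬; T-∧; T-∨)
  open import Data.Empty using (⊥; ⊥-elim)
  open import Data.Maybe using (Maybe; just; nothing)
  import Data.Maybe as Maybe
  open import Data.Maybe.Properties using (just-injective)
  open import Data.Nat using (ℕ) renaming (_≟_ to _≟ℕ_)
  open import Data.Product using (_,_; ∃; proj₁; proj₂; uncurry; swap)
  open import Data.Product.Properties using (≡-dec)
  open import Data.Sum using (_⊎_; inj₁; inj₂; [_,_]; [_,_]′)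
  import Data.Sum as Sum
  open import Data.List using (List; []; _∷_; _++_; foldr; cartesianProductWith)
  open import Data.List.Properties using (foldr-++)
  open import Data.List.Membership.Propositional using (_∈_; lose)
  open import Data.List.Membership.Propositional.Properties
    using (∈-++⁺ˡ; ∈-++⁺ʳ; ∈-++⁻; ∈-cartesianProductWith⁺; ∈-cartesianProductWith⁻)
  open import Data.List.Membership.DecPropositional (≡-dec _≟ℕ_ Boolₚ._≟_) using (_∈?_)
  open import Data.List.Relation.Binary.Subset.Propositional using (_⊆_)
  open import Data.List.Relation.Binary.Subset.Propositional.Properties
    using (⊆-refl; xs⊆xs++ys; xs⊆ys++xs)
  open import Data.List.Relation.Unary.Any using (here; there; any?; satisfied)
  open import Function.Base using (_∘_; case_of_)
  open import Function.Bundles using (_⇔_; mk⇔; Equivalence)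
  open import Relation.Binary.PropositionalEquality hiding ([_])
  open import Relation.Nullary using (Dec; yes; no; ¬_)
  open import Relation.Nullary.Decidable using (isYes; _×-dec_; _⊎-dec_; toWitness; fromWitness)

  open Alg using (Carrier)
  open Equivalence using (to; from)
  open ≡-Reasoning

  -- Negation normal forms

  𝟚 : Alg
  𝟚 = record { Carrier = Bool ; _⊓_ = _∧_ ; _⊔'_ = _∨_ ; ∼_ = not }

  conn : (A : Alg) → Bool → Carrier A → Carrier A → Carrier A
  conn A true  = Alg._⊓_ A
  conn A false = Alg._⊔'_ A

  -- ℓ x true and ℓ x false are the values of the literals x and ¬ x; evalNNF A ℓ p t is the value
  -- of the negation normal form of t (p = true) or of ¬ t (p = false).
  evalNNF : (A : Alg) → (ℕ → Bool → Carrier A) → Bool → Term → Carrier A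
  evalNNF A ℓ p (var x)  = ℓ x p
  evalNNF A ℓ p (t ∧ₜ s) = conn A p (evalNNF A ℓ p t) (evalNNF A ℓ p s)
  evalNNF A ℓ p (t ∨ₜ s) = conn A (not p) (evalNNF A ℓ p t) (evalNNF A ℓ p s)
  evalNNF A ℓ p (¬ₜ t)   = evalNNF A ℓ (not p) t

  lit : (A : Alg) → Bool → Carrier A → Carrier A
  lit A true  v = v
  lit A false v = Alg.∼_ A v

  literal : (A : Alg) → (ℕ → Carrier A) → ℕ → Bool → Carrier A
  literal A ρ x q = lit A q (ρ x)

  record DeMorganNegation (A : Alg) : Set where
    open Alg A
    field
      dneg : ∀ x → (∼ (∼ x)) ≡ x
      dm-∧ : ∀ x y → (∼ (x ⊓ y)) ≡ ((∼ x) ⊔' (∼ y))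
      dm-∨ : ∀ x y → (∼ (x ⊔' y)) ≡ ((∼ x) ⊓ (∼ y))

  IsDML⇒DeMorganNegation : ∀ {A} → IsDML A → DeMorganNegation A
  IsDML⇒DeMorganNegation d = record { dneg = dneg ; dm-∧ = dm-∧ ; dm-∨ = dm-∨ }
    where open IsDML d

  module _ {A : Alg} (dm : DeMorganNegation A) (ρ : ℕ → Carrier A) where
    open Alg A
    open DeMorganNegation dm

    evalNNF-eval  : ∀ t → evalNNF A (literal A ρ) true t ≡ eval A ρ t
    evalNNF-∼eval : ∀ t → evalNNF A (literal A ρ) false t ≡ (∼ eval A ρ t)
    evalNNF-eval (var x)   = refl
    evalNNF-eval (t ∧ₜ s)  = cong₂ _⊓_ (evalNNF-eval t) (evalNNF-eval s)
    evalNNF-eval (t ∨ₜ s)  = cong₂ _⊔'_ (evalNNF-eval t) (evalNNF-eval s)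
    evalNNF-eval (¬ₜ t)    = evalNNF-∼eval t
    evalNNF-∼eval (var x)  = refl
    evalNNF-∼eval (t ∧ₜ s) = trans (cong₂ _⊔'_ (evalNNF-∼eval t) (evalNNF-∼eval s)) (sym (dm-∧ _ _))
    evalNNF-∼eval (t ∨ₜ s) = trans (cong₂ _⊓_ (evalNNF-∼eval t) (evalNNF-∼eval s)) (sym (dm-∨ _ _))
    evalNNF-∼eval (¬ₜ t)   = trans (evalNNF-eval t) (sym (dneg _))

  evalNNF-map : ∀ {A B} (h : Carrier A → Carrier B) →
                (∀ p v w → h (conn A p v w) ≡ conn B p (h v) (h w)) →
                ∀ ℓ p t → h (evalNNF A ℓ p t) ≡ evalNNF B (λ x q → h (ℓ x q)) p t
  evalNNF-map h h-conn ℓ p (var x)  = refl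
  evalNNF-map h h-conn ℓ p (t ∧ₜ s) = trans (h-conn p _ _)
    (cong₂ (conn _ p) (evalNNF-map h h-conn ℓ p t) (evalNNF-map h h-conn ℓ p s))
  evalNNF-map h h-conn ℓ p (t ∨ₜ s) = trans (h-conn (not p) _ _)
    (cong₂ (conn _ (not p)) (evalNNF-map h h-conn ℓ p t) (evalNNF-map h h-conn ℓ p s))
  evalNNF-map h h-conn ℓ p (¬ₜ t)   = evalNNF-map h h-conn ℓ (not p) t

  AllLiterals : (ℕ → Bool → Set) → Bool → Term → Set
  AllLiterals P p (var x)  = P x p
  AllLiterals P p (t ∧ₜ s) = AllLiterals P p t × AllLiterals P p s
  AllLiterals P p (t ∨ₜ s) = AllLiterals P p t × AllLiterals P p s
  AllLiterals P p (¬ₜ t)   = AllLiterals P (not p) t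

  evalNNF-cong : ∀ {A ℓ ℓ′} p t → AllLiterals (λ x q → ℓ x q ≡ ℓ′ x q) p t →
                 evalNNF A ℓ p t ≡ evalNNF A ℓ′ p t
  evalNNF-cong p (var x)  e          = e
  evalNNF-cong p (t ∧ₜ s) (e₁ , e₂) = cong₂ (conn _ p) (evalNNF-cong p t e₁) (evalNNF-cong p s e₂)
  evalNNF-cong p (t ∨ₜ s) (e₁ , e₂) = cong₂ (conn _ (not p)) (evalNNF-cong p t e₁) (evalNNF-cong p s e₂)
  evalNNF-cong p (¬ₜ t)   e          = evalNNF-cong (not p) t e

  evalNNF-all : ∀ {A ℓ} (S : Carrier A → Set) → (∀ p v w → S (conn A p v w) ⇔ (S v × S w)) →
                ∀ p t → S (evalNNF A ℓ p t) ⇔ AllLiterals (λ x q → S (ℓ x q)) p t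
  evalNNF-all {A} {ℓ} S conn-both p t = mk⇔ (down p t) (up p t)
    where
    down : ∀ p t → S (evalNNF A ℓ p t) → AllLiterals (λ x q → S (ℓ x q)) p t
    down p (var x)  h = h
    down p (t ∧ₜ s) h = let h₁ , h₂ = to (conn-both p _ _) h in down p t h₁ , down p s h₂
    down p (t ∨ₜ s) h = let h₁ , h₂ = to (conn-both (not p) _ _) h in down p t h₁ , down p s h₂
    down p (¬ₜ t)   h = down (not p) t h
    up : ∀ p t → AllLiterals (λ x q → S (ℓ x q)) p t → S (evalNNF A ℓ p t)
    up p (var x)  h          = h
    up p (t ∧ₜ s) (h₁ , h₂) = from (conn-both p _ _) (up p t h₁ , up p s h₂)
    up p (t ∨ₜ s) (h₁ , h₂) = from (conn-both (not p) _ _) (up p t h₁ , up p s h₂)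
    up p (¬ₜ t)   h          = up (not p) t h

  allLiterals⇔ : ∀ {P} t → AllLiterals P true t ⇔ (∀ q x → occ q x t → P x q)
  allLiterals⇔ {P} t = mk⇔
    (λ h → λ { true → proj₁ (spread true t h) ; false → proj₂ (spread true t h) })
    (λ f → gather true t (f true , f false))
    where
    Occurring : Bool → Term → Set
    Occurring p t = (∀ x → occ p x t → P x true) × (∀ x → occ (not p) x t → P x false)
    spread : ∀ p t → AllLiterals P p t → Occurring p t
    spread true  (var y) h = (λ { x (refl , refl) → h }) , (λ { x (() , _) })
    spread false (var y) h = (λ { x (() , _) }) , (λ { x (refl , refl) → h })
    spread p (t ∧ₜ s) (h₁ , h₂) =
      let pos₁ , neg₁ = spread p t h₁ ; pos₂ , neg₂ = spread p s h₂
      in (λ x → [ pos₁ x , pos₂ x ]) , (λ x → [ neg₁ x , neg₂ x ])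
    spread p (t ∨ₜ s) (h₁ , h₂) =
      let pos₁ , neg₁ = spread p t h₁ ; pos₂ , neg₂ = spread p s h₂
      in (λ x → [ pos₁ x , pos₂ x ]) , (λ x → [ neg₁ x , neg₂ x ])
    spread p (¬ₜ t) h = spread (not p) t h
    gather : ∀ p t → Occurring p t → AllLiterals P p t
    gather true  (var y) (pos , _) = pos y (refl , refl)
    gather false (var y) (_ , neg) = neg y (refl , refl)
    gather p (t ∧ₜ s) (pos , neg) =
      gather p t ((λ x → pos x ∘ inj₁) , (λ x → neg x ∘ inj₁)) ,
      gather p s ((λ x → pos x ∘ inj₂) , (λ x → neg x ∘ inj₂))
    gather p (t ∨ₜ s) (pos , neg) =
      gather p t ((λ x → pos x ∘ inj₁) , (λ x → neg x ∘ inj₁)) ,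
      gather p s ((λ x → pos x ∘ inj₂) , (λ x → neg x ∘ inj₂))
    gather p (¬ₜ t) h = gather (not p) t h

  -- Occurrences and polarity

  _⊑_ : Term → Term → Set
  ψ ⊑ φ = ∀ q x → occ q x ψ → occ q x φ

  AllLiterals-⊑ : ∀ {P} φ ψ → ψ ⊑ φ → AllLiterals P true φ → AllLiterals P true ψ
  AllLiterals-⊑ φ ψ ψ⊑φ h = from (allLiterals⇔ ψ) λ q x o → to (allLiterals⇔ φ) h q x (ψ⊑φ q x o)

  balanced⇔⊑ : ∀ φ ψ → BalancedRegular φ ψ ⇔ (ψ ⊑ φ × φ ⊑ ψ)
  balanced⇔⊑ φ ψ = mk⇔
    (λ (pos , neg) → (λ { true x → from (pos x) ; false x → from (neg x) })
                   , (λ { true x → to (pos x) ; false x → to (neg x) }))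
    (λ (ψ⊑φ , φ⊑ψ) → (λ x → mk⇔ (φ⊑ψ true x) (ψ⊑φ true x))
                   , (λ x → mk⇔ (φ⊑ψ false x) (ψ⊑φ false x)))

  balanced-sym : ∀ {φ ψ} → BalancedRegular φ ψ → BalancedRegular ψ φ
  balanced-sym {φ} {ψ} = from (balanced⇔⊑ ψ φ) ∘ swap ∘ to (balanced⇔⊑ φ ψ)

  balanced⇒regular : ∀ {φ ψ} → BalancedRegular φ ψ → Regular φ ψ
  balanced⇒regular (pos , neg) x =
    mk⇔ (Sum.map (to (pos x)) (to (neg x))) (Sum.map (from (pos x)) (from (neg x)))

  BipolarTerm : Term → Set
  BipolarTerm t = ∃ λ x → Var⁺ t x × Var⁻ t x

  Unipolar : Term → Set
  Unipolar t = ∀ x → Var⁺ t x → Var⁻ t x → ⊥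

  occ? : ∀ q x t → Dec (occ q x t)
  occ? q x (var y)  = (q Boolₚ.≟ true) ×-dec (x ≟ℕ y)
  occ? q x (t ∧ₜ s) = occ? q x t ⊎-dec occ? q x s
  occ? q x (t ∨ₜ s) = occ? q x t ⊎-dec occ? q x s
  occ? q x (¬ₜ t)   = occ? (not q) x t

  vars : Term → List ℕ
  vars (var x)  = x ∷ []
  vars (t ∧ₜ s) = vars t ++ vars s
  vars (t ∨ₜ s) = vars t ++ vars s
  vars (¬ₜ t)   = vars t

  occ⇒∈vars : ∀ {q x} t → occ q x t → x ∈ vars t
  occ⇒∈vars (var y)  (_ , refl) = here refl
  occ⇒∈vars (t ∧ₜ s) (inj₁ o)   = ∈-++⁺ˡ (occ⇒∈vars t o)
  occ⇒∈vars (t ∧ₜ s) (inj₂ o)   = ∈-++⁺ʳ (vars t) (occ⇒∈vars s o)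
  occ⇒∈vars (t ∨ₜ s) (inj₁ o)   = ∈-++⁺ˡ (occ⇒∈vars t o)
  occ⇒∈vars (t ∨ₜ s) (inj₂ o)   = ∈-++⁺ʳ (vars t) (occ⇒∈vars s o)
  occ⇒∈vars (¬ₜ t)   o          = occ⇒∈vars t o

  bipolar? : ∀ t → BipolarTerm t ⊎ Unipolar t
  bipolar? t with any? (λ x → occ? true x t ×-dec occ? false x t) (vars t)
  ... | yes bipolar = inj₁ (satisfied bipolar)
  ... | no ¬bipolar = inj₂ λ x o⁺ o⁻ → ¬bipolar (lose (occ⇒∈vars t o⁺) (o⁺ , o⁻))

  -- Validity in De Morgan lattices

  LiteralValid : Term → Term → Set
  LiteralValid φ ψ = ∀ τ → evalNNF 𝟚 τ true φ ≡ evalNNF 𝟚 τ true ψ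

  -- 𝟚 × 𝟚ᵒᵖ with negation swapping the coordinates: in the first coordinate the two literals of
  -- a variable are evaluated independently.
  M₄ : Alg
  M₄ = record
    { Carrier = Bool × Bool
    ; _⊓_     = λ v w → proj₁ v ∧ proj₁ w , proj₂ v ∨ proj₂ w
    ; _⊔'_    = λ v w → proj₁ v ∨ proj₁ w , proj₂ v ∧ proj₂ w
    ; ∼_      = swap
    }

  M₄-isDML : IsDML M₄
  M₄-isDML = record
    { ∧-comm   = λ v w → cong₂ _,_ (Boolₚ.∧-comm (proj₁ v) (proj₁ w)) (Boolₚ.∨-comm (proj₂ v) (proj₂ w))
    ; ∨-comm   = λ v w → cong₂ _,_ (Boolₚ.∨-comm (proj₁ v) (proj₁ w)) (Boolₚ.∧-comm (proj₂ v) (proj₂ w))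
    ; ∧-assoc  = λ v _ _ → cong₂ _,_ (Boolₚ.∧-assoc (proj₁ v) _ _) (Boolₚ.∨-assoc (proj₂ v) _ _)
    ; ∨-assoc  = λ v _ _ → cong₂ _,_ (Boolₚ.∨-assoc (proj₁ v) _ _) (Boolₚ.∧-assoc (proj₂ v) _ _)
    ; ∧-absorb = λ v _ → cong₂ _,_ (Boolₚ.∧-abs-∨ (proj₁ v) _) (Boolₚ.∨-abs-∧ (proj₂ v) _)
    ; ∨-absorb = λ v _ → cong₂ _,_ (Boolₚ.∨-abs-∧ (proj₁ v) _) (Boolₚ.∧-abs-∨ (proj₂ v) _)
    ; distrib  = λ v _ _ → cong₂ _,_ (Boolₚ.∧-distribˡ-∨ (proj₁ v) _ _) (Boolₚ.∨-distribˡ-∧ (proj₂ v) _ _)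
    ; dneg     = λ _ → refl
    ; dm-∧     = λ _ _ → refl
    ; dm-∨     = λ _ _ → refl
    }

  evalNNF-𝟚≡proj₁-eval-M₄ : ∀ τ t →
                            evalNNF 𝟚 τ true t ≡ proj₁ (eval M₄ (λ x → τ x true , τ x false) t)
  evalNNF-𝟚≡proj₁-eval-M₄ τ t = begin
    evalNNF 𝟚 τ true t
      ≡⟨ evalNNF-cong true t (from (allLiterals⇔ t) λ { true _ _ → refl ; false _ _ → refl }) ⟩
    evalNNF 𝟚 (λ x q → proj₁ (literal M₄ ρ x q)) true t
      ≡⟨ evalNNF-map proj₁ (λ { true _ _ → refl ; false _ _ → refl }) (literal M₄ ρ) true t ⟨
    proj₁ (evalNNF M₄ (literal M₄ ρ) true t)
      ≡⟨ cong proj₁ (evalNNF-eval (IsDML⇒DeMorganNegation M₄-isDML) ρ t) ⟩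
    proj₁ (eval M₄ ρ t) ∎
    where
    ρ : ℕ → Bool × Bool
    ρ x = τ x true , τ x false

  DML⇒literalValid : ∀ φ ψ → Id DML φ ψ → LiteralValid φ ψ
  DML⇒literalValid φ ψ valid τ = begin
    evalNNF 𝟚 τ true φ                             ≡⟨ evalNNF-𝟚≡proj₁-eval-M₄ τ φ ⟩
    proj₁ (eval M₄ (λ x → τ x true , τ x false) φ) ≡⟨ cong proj₁ (valid M₄ (lift M₄-isDML) _) ⟩
    proj₁ (eval M₄ (λ x → τ x true , τ x false) ψ) ≡⟨ evalNNF-𝟚≡proj₁-eval-M₄ τ ψ ⟨
    evalNNF 𝟚 τ true ψ                             ∎

  Clause : Set
  Clause = List (ℕ × Bool)

  dnf-conn : Bool → List Clause → List Clause → List Clause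
  dnf-conn true  = cartesianProductWith _++_
  dnf-conn false = _++_

  dnf : Bool → Term → List Clause
  dnf p (var x)  = ((x , p) ∷ []) ∷ []
  dnf p (t ∧ₜ s) = dnf-conn p (dnf p t) (dnf p s)
  dnf p (t ∨ₜ s) = dnf-conn (not p) (dnf p t) (dnf p s)
  dnf p (¬ₜ t)   = dnf (not p) t

  clauseTruth : Clause → ℕ → Bool → Bool
  clauseTruth C x q = isYes ((x , q) ∈? C)

  Satisfies : List Clause → (Clause → Bool) → Set
  Satisfies L f = ∀ {C C′} → C ∈ L → C ⊆ C′ → T (f C′)

  satisfies-conn : ∀ p {L₁ L₂ f₁ f₂} → Satisfies L₁ f₁ → Satisfies L₂ f₂ →
                   Satisfies (dnf-conn p L₁ L₂) (λ C′ → conn 𝟚 p (f₁ C′) (f₂ C′))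
  satisfies-conn true {L₁} {L₂} sat₁ sat₂ m C⊆C′
    with C₁ , C₂ , m₁ , m₂ , refl ← ∈-cartesianProductWith⁻ _++_ L₁ L₂ m =
    from T-∧ (sat₁ m₁ (C⊆C′ ∘ xs⊆xs++ys C₁ C₂) , sat₂ m₂ (C⊆C′ ∘ xs⊆ys++xs C₂ C₁))
  satisfies-conn false {L₁} sat₁ sat₂ m C⊆C′ =
    from T-∨ (Sum.map (λ m₁ → sat₁ m₁ C⊆C′) (λ m₂ → sat₂ m₂ C⊆C′) (∈-++⁻ L₁ m))

  dnf-satisfies : ∀ p t → Satisfies (dnf p t) (λ C′ → evalNNF 𝟚 (clauseTruth C′) p t)
  dnf-satisfies p (var x)  (here refl) C⊆C′ = fromWitness (C⊆C′ (here refl))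
  dnf-satisfies p (t ∧ₜ s) = satisfies-conn p (dnf-satisfies p t) (dnf-satisfies p s)
  dnf-satisfies p (t ∨ₜ s) = satisfies-conn (not p) (dnf-satisfies p t) (dnf-satisfies p s)
  dnf-satisfies p (¬ₜ t)   = dnf-satisfies (not p) t

  module Clauses {D : Alg} (isDML : IsDML D) (ρ : ℕ → Carrier D) where
    open Alg D hiding (Carrier)
    open IsDML isDML

    lattice : Lattice 0ℓ 0ℓ
    lattice = record
      { Carrier   = Carrier D
      ; _≈_       = _≡_
      ; _∨_       = _⊔'_
      ; _∧_       = _⊓_
      ; isLattice = record
        { isEquivalence = isEquivalence
        ; ∨-comm        = ∨-comm
        ; ∨-assoc       = ∨-assoc
        ; ∨-cong        = cong₂ _⊔'_
        ; ∧-comm        = ∧-comm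
        ; ∧-assoc       = ∧-assoc
        ; ∧-cong        = cong₂ _⊓_
        ; absorptive    = ∨-absorb , ∧-absorb
        }
      }

    open LatticeProperties lattice using (∧-idem; ∨-∧-orderTheoreticLattice)
    open OrderTheoretic.Lattice ∨-∧-orderTheoreticLattice
      using (_≤_; antisym; x∧y≤x; x∧y≤y; ∧-greatest; x≤x∨y; y≤x∨y; ∨-least)
      renaming (trans to ≤-trans)

    ⟦_⟧ₙ : Term → Carrier D
    ⟦ t ⟧ₙ = evalNNF D (literal D ρ) true t

    clauseMeet : Carrier D → Clause → Carrier D
    clauseMeet Z = foldr (λ l m → uncurry (literal D ρ) l ⊓ m) Z

    clauseMeet-⊓ : ∀ Z W C → clauseMeet (Z ⊓ W) C ≡ clauseMeet Z C ⊓ W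
    clauseMeet-⊓ Z W []      = refl
    clauseMeet-⊓ Z W (l ∷ C) = trans (cong (_ ⊓_) (clauseMeet-⊓ Z W C)) (sym (∧-assoc _ _ _))

    clauseMeet-≤ : ∀ {l Z C} → l ∈ C → clauseMeet Z C ≤ uncurry (literal D ρ) l
    clauseMeet-≤ (here refl) = x∧y≤x _ _
    clauseMeet-≤ (there m)   = ≤-trans (x∧y≤y _ _) (clauseMeet-≤ m)

    -- e lies below the join of the clauses of L, stated relative to an arbitrary Z because a
    -- De Morgan lattice has no top element to serve as the meet of the empty clause.
    Below : List Clause → Carrier D → Set
    Below L e = ∀ Z X → (∀ {C} → C ∈ L → clauseMeet Z C ≤ X) → (Z ⊓ e) ≤ X

    below-conn : ∀ p {L₁ L₂ e₁ e₂} → Below L₁ e₁ → Below L₂ e₂ →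
                 Below (dnf-conn p L₁ L₂) (conn D p e₁ e₂)
    below-conn true {L₁} {L₂} {e₁} {e₂} below₁ below₂ Z X h =
      subst (_≤ X) (∧-assoc Z e₁ e₂)
        (below₂ (Z ⊓ e₁) X λ {C₂} m₂ → subst (_≤ X) (sym (clauseMeet-⊓ Z e₁ C₂))
          (below₁ (clauseMeet Z C₂) X λ {C₁} m₁ → subst (_≤ X) (foldr-++ _ Z C₁ C₂)
            (h (∈-cartesianProductWith⁺ _++_ m₁ m₂))))
    below-conn false {L₁} {L₂} {e₁} {e₂} below₁ below₂ Z X h =
      subst (_≤ X) (sym (distrib Z e₁ e₂))
        (∨-least (below₁ Z X (h ∘ ∈-++⁺ˡ)) (below₂ Z X (h ∘ ∈-++⁺ʳ L₁)))

    below-dnf : ∀ p t → Below (dnf p t) (evalNNF D (literal D ρ) p t)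
    below-dnf p (var x)  Z X h = subst (_≤ X) (∧-comm _ Z) (h (here refl))
    below-dnf p (t ∧ₜ s) = below-conn p (below-dnf p t) (below-dnf p s)
    below-dnf p (t ∨ₜ s) = below-conn (not p) (below-dnf p t) (below-dnf p s)
    below-dnf p (¬ₜ t)   = below-dnf (not p) t

    conn-≤ : ∀ p {b₁ b₂ m e₁ e₂} → (T b₁ → m ≤ e₁) → (T b₂ → m ≤ e₂) →
             T (conn 𝟚 p b₁ b₂) → m ≤ conn D p e₁ e₂
    conn-≤ true  f g h = let h₁ , h₂ = to T-∧ h in ∧-greatest (f h₁) (g h₂)
    conn-≤ false f g h =
      [ (λ h₁ → ≤-trans (f h₁) (x≤x∨y _ _)) , (λ h₂ → ≤-trans (g h₂) (y≤x∨y _ _)) ] (to T-∨ h)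

    clause-≤ : ∀ p t {C} Z → T (evalNNF 𝟚 (clauseTruth C) p t) →
               clauseMeet Z C ≤ evalNNF D (literal D ρ) p t
    clause-≤ p (var x)  Z h = clauseMeet-≤ (toWitness h)
    clause-≤ p (t ∧ₜ s) Z   = conn-≤ p (clause-≤ p t Z) (clause-≤ p s Z)
    clause-≤ p (t ∨ₜ s) Z   = conn-≤ (not p) (clause-≤ p t Z) (clause-≤ p s Z)
    clause-≤ p (¬ₜ t)   Z   = clause-≤ (not p) t Z

    literalValid⇒≤ : ∀ φ ψ → LiteralValid φ ψ → ⟦ φ ⟧ₙ ≤ ⟦ ψ ⟧ₙ
    literalValid⇒≤ φ ψ valid = subst (_≤ ⟦ ψ ⟧ₙ) (∧-idem ⟦ φ ⟧ₙ)
      (below-dnf true φ ⟦ φ ⟧ₙ ⟦ ψ ⟧ₙ λ {C} m →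
        clause-≤ true ψ ⟦ φ ⟧ₙ (subst T (valid (clauseTruth C)) (dnf-satisfies true φ m ⊆-refl)))

    literalValid⇒≡ : ∀ φ ψ → LiteralValid φ ψ → ⟦ φ ⟧ₙ ≡ ⟦ ψ ⟧ₙ
    literalValid⇒≡ φ ψ valid = antisym (literalValid⇒≤ φ ψ valid) (literalValid⇒≤ ψ φ (sym ∘ valid))

  literalValid⇒DML : ∀ φ ψ → LiteralValid φ ψ → Id DML φ ψ
  literalValid⇒DML φ ψ valid D (lift isDML) ρ = begin
    eval D ρ φ                     ≡⟨ evalNNF-eval dm ρ φ ⟨
    evalNNF D (literal D ρ) true φ ≡⟨ Clauses.literalValid⇒≡ isDML ρ φ ψ valid ⟩
    evalNNF D (literal D ρ) true ψ ≡⟨ evalNNF-eval dm ρ ψ ⟩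
    eval D ρ ψ                     ∎
    where dm = IsDML⇒DeMorganNegation isDML

  -- The algebra A₅

  A5C-cases : {P : A5C → Set} → P a → P b → P a' → P b' → P u → ∀ x → P x
  A5C-cases pa pb pa' pb' pu a  = pa
  A5C-cases pa pb pa' pb' pu b  = pb
  A5C-cases pa pb pa' pb' pu a' = pa'
  A5C-cases pa pb pa' pb' pu b' = pb'
  A5C-cases pa pb pa' pb' pu u  = pu

  A₅-deMorgan : DeMorganNegation A₅
  A₅-deMorgan = record
    { dneg = A5C-cases refl refl refl refl refl
    ; dm-∧ = A5C-cases
        (A5C-cases refl refl refl refl refl) (A5C-cases refl refl refl refl refl)
        (A5C-cases refl refl refl refl refl) (A5C-cases refl refl refl refl refl)
        (A5C-cases refl refl refl refl refl)
    ; dm-∨ = A5C-cases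
        (A5C-cases refl refl refl refl refl) (A5C-cases refl refl refl refl refl)
        (A5C-cases refl refl refl refl refl) (A5C-cases refl refl refl refl refl)
        (A5C-cases refl refl refl refl refl)
    }

  -- A₅ is u together with two copies, b < a (s = true) and a' < b' (s = false), of the two-element
  -- lattice; at s v is the element of value v in copy s (value u is junk).
  at : Bool → Bool → A5C
  at true  true  = a
  at true  false = b
  at false true  = b'
  at false false = a'

  summand : A5C → Maybe Bool
  summand a  = just true
  summand b  = just true
  summand a' = just false
  summand b' = just false
  summand u  = nothing

  value : A5C → Bool
  value a  = true
  value b  = false
  value a' = false
  value b' = true
  value u  = false

  _⊓ₛ_ : Maybe Bool → Maybe Bool → Maybe Bool
  just true  ⊓ₛ just true  = just true
  just false ⊓ₛ just false = just false
  _          ⊓ₛ _          = nothing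

  ⊓ₛ-just : ∀ m n {s} → m ⊓ₛ n ≡ just s ⇔ (m ≡ just s × n ≡ just s)
  ⊓ₛ-just m n = mk⇔ (inversion m n) construction
    where
    inversion : ∀ m n {s} → m ⊓ₛ n ≡ just s → m ≡ just s × n ≡ just s
    inversion (just true)  (just true)  refl = refl , refl
    inversion (just false) (just false) refl = refl , refl
    inversion (just true)  (just false) ()
    inversion (just false) (just true)  ()
    inversion (just true)  nothing      ()
    inversion (just false) nothing      ()
    inversion nothing      _            ()
    construction : ∀ {m n s} → m ≡ just s × n ≡ just s → m ⊓ₛ n ≡ just s
    construction {s = true}  (refl , refl) = refl
    construction {s = false} (refl , refl) = refl

  summand-⊓ : ∀ x y → summand (a5-meet x y) ≡ summand x ⊓ₛ summand y
  summand-⊓ = A5C-cases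
    (A5C-cases refl refl refl refl refl) (A5C-cases refl refl refl refl refl)
    (A5C-cases refl refl refl refl refl) (A5C-cases refl refl refl refl refl)
    (A5C-cases refl refl refl refl refl)

  summand-⊔ : ∀ x y → summand (a5-join x y) ≡ summand x ⊓ₛ summand y
  summand-⊔ = A5C-cases
    (A5C-cases refl refl refl refl refl) (A5C-cases refl refl refl refl refl)
    (A5C-cases refl refl refl refl refl) (A5C-cases refl refl refl refl refl)
    (A5C-cases refl refl refl refl refl)

  summand-∼ : ∀ x → summand (a5-neg x) ≡ Maybe.map not (summand x)
  summand-∼ = A5C-cases refl refl refl refl refl

  summand-conn : ∀ p x y {s} →
                 summand (conn A₅ p x y) ≡ just s ⇔ (summand x ≡ just s × summand y ≡ just s)
  summand-conn true  x y =
    mk⇔ (to (⊓ₛ-just _ _) ∘ trans (sym (summand-⊓ x y))) (trans (summand-⊓ x y) ∘ from (⊓ₛ-just _ _))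
  summand-conn false x y =
    mk⇔ (to (⊓ₛ-just _ _) ∘ trans (sym (summand-⊔ x y))) (trans (summand-⊔ x y) ∘ from (⊓ₛ-just _ _))

  summand-just : ∀ {x s} → summand x ≡ just s → x ≡ at s (value x)
  summand-just {a}  refl = refl
  summand-just {b}  refl = refl
  summand-just {a'} refl = refl
  summand-just {b'} refl = refl

  summand-nothing : ∀ {x} → summand x ≡ nothing → x ≡ u
  summand-nothing {u} refl = refl

  summand-at : ∀ s v → summand (at s v) ≡ just s
  summand-at true  true  = refl
  summand-at true  false = refl
  summand-at false true  = refl
  summand-at false false = refl

  summand-∼at : ∀ v → summand (a5-neg (at true v)) ≡ just false
  summand-∼at v = trans (summand-∼ (at true v)) (cong (Maybe.map not) (summand-at true v))

  value-at : ∀ s v → value (at s v) ≡ v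
  value-at true  true  = refl
  value-at true  false = refl
  value-at false true  = refl
  value-at false false = refl

  ∼-at : ∀ s v → a5-neg (at s v) ≡ at (not s) (not v)
  ∼-at true  true  = refl
  ∼-at true  false = refl
  ∼-at false true  = refl
  ∼-at false false = refl

  at-conn : ∀ p s v w → at s (conn 𝟚 p v w) ≡ conn A₅ p (at s v) (at s w)
  at-conn true  true  true  true  = refl
  at-conn true  true  true  false = refl
  at-conn true  true  false true  = refl
  at-conn true  true  false false = refl
  at-conn true  false true  true  = refl
  at-conn true  false true  false = refl
  at-conn true  false false true  = refl
  at-conn true  false false false = refl
  at-conn false true  true  true  = refl
  at-conn false true  true  false = refl
  at-conn false true  false true  = refl
  at-conn false true  false false = refl
  at-conn false false true  true  = refl
  at-conn false false true  false = refl
  at-conn false false false true  = refl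
  at-conn false false false false = refl

  A₅-summand-literals : ∀ {ρ s} t → summand (eval A₅ ρ t) ≡ just s →
                        ∀ q x → occ q x t → summand (literal A₅ ρ x q) ≡ just s
  A₅-summand-literals {ρ} {s} t e = to (allLiterals⇔ t) (to in-summand (subst InSummand eval≡evalNNF e))
    where
    InSummand : A5C → Set
    InSummand v = summand v ≡ just s
    eval≡evalNNF = sym (evalNNF-eval A₅-deMorgan ρ t)
    in-summand = evalNNF-all {A₅} InSummand (λ p v w → summand-conn p v w) true t

  A₅-eval-at : ∀ {ρ s} τ t → AllLiterals (λ x q → literal A₅ ρ x q ≡ at s (τ x q)) true t →
               eval A₅ ρ t ≡ at s (evalNNF 𝟚 τ true t)
  A₅-eval-at {ρ} {s} τ t h = begin
    eval A₅ ρ t                               ≡⟨ evalNNF-eval A₅-deMorgan ρ t ⟨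
    evalNNF A₅ (literal A₅ ρ) true t          ≡⟨ evalNNF-cong true t h ⟩
    evalNNF A₅ (λ x q → at s (τ x q)) true t  ≡⟨ evalNNF-map {𝟚} {A₅} (at s) (λ p → at-conn p s) τ true t ⟨
    at s (evalNNF 𝟚 τ true t)                 ∎

  A₅-bipolar≡u : ∀ {ρ} t → BipolarTerm t → eval A₅ ρ t ≡ u
  A₅-bipolar≡u {ρ} t (x , o⁺ , o⁻) with summand (eval A₅ ρ t) in e
  ... | nothing = summand-nothing e
  ... | just s  = ⊥-elim (not-¬ refl (sym (just-injective (begin
    just (not s)                   ≡⟨ cong (Maybe.map not) (A₅-summand-literals t e true x o⁺) ⟨
    Maybe.map not (summand (ρ x))  ≡⟨ summand-∼ (ρ x) ⟨
    summand (a5-neg (ρ x))         ≡⟨ A₅-summand-literals t e false x o⁻ ⟩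
    just s                         ∎))))

  A₅-balanced-agree : ∀ φ ψ {ρ s} → BalancedRegular φ ψ → LiteralValid φ ψ →
                      summand (eval A₅ ρ φ) ≡ just s → eval A₅ ρ φ ≡ eval A₅ ρ ψ
  A₅-balanced-agree φ ψ {ρ} {s} bal valid e = begin
    eval A₅ ρ φ               ≡⟨ A₅-eval-at τ φ (at-value φ λ _ _ o → o) ⟩
    at s (evalNNF 𝟚 τ true φ) ≡⟨ cong (at s) (valid τ) ⟩
    at s (evalNNF 𝟚 τ true ψ) ≡⟨ A₅-eval-at τ ψ (at-value ψ (proj₁ (to (balanced⇔⊑ φ ψ) bal))) ⟨
    eval A₅ ρ ψ               ∎
    where
    τ : ℕ → Bool → Bool
    τ x q = value (literal A₅ ρ x q)
    at-value : ∀ t → t ⊑ φ → AllLiterals (λ x q → literal A₅ ρ x q ≡ at s (τ x q)) true t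
    at-value t t⊑φ = from (allLiterals⇔ t) λ q x o →
      summand-just (A₅-summand-literals φ e q x (t⊑φ q x o))

  A₅-balanced-sound : ∀ φ ψ → BalancedRegular φ ψ → LiteralValid φ ψ → A₅ ⊨ φ ≈ ψ
  A₅-balanced-sound φ ψ bal valid ρ with summand (eval A₅ ρ φ) in eφ | summand (eval A₅ ρ ψ) in eψ
  ... | just _  | _       = A₅-balanced-agree φ ψ bal valid eφ
  ... | nothing | just _  = sym (A₅-balanced-agree ψ φ (balanced-sym {φ} {ψ} bal) (sym ∘ valid) eψ)
  ... | nothing | nothing = trans (summand-nothing eφ) (sym (summand-nothing eψ))

  -- Sending the variables not in t to u lets realise-summand⇒occ read the occurrences of t back.
  realise : Term → (ℕ → Bool → Bool) → ℕ → A5C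
  realise t τ x with occ? true x t | occ? false x t
  ... | yes _ | _     = at true (τ x true)
  ... | no _  | yes _ = at false (not (τ x false))
  ... | no _  | no _  = u

  realise-literal : ∀ t τ → Unipolar t →
                    AllLiterals (λ x q → literal A₅ (realise t τ) x q ≡ at true (τ x q)) true t
  realise-literal t τ unipolar = from (allLiterals⇔ t) literal-at
    where
    literal-at : ∀ q x → occ q x t → literal A₅ (realise t τ) x q ≡ at true (τ x q)
    literal-at true x o with occ? true x t
    ... | yes _ = refl
    ... | no ¬o = ⊥-elim (¬o o)
    literal-at false x o with occ? true x t | occ? false x t
    ... | yes o⁺ | _     = ⊥-elim (unipolar x o⁺ o)
    ... | no _   | yes _ = trans (∼-at false (not (τ x false))) (cong (at true) (not-involutive (τ x false)))
    ... | no _   | no ¬o = ⊥-elim (¬o o)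

  realise-eval : ∀ t τ → Unipolar t → eval A₅ (realise t τ) t ≡ at true (evalNNF 𝟚 τ true t)
  realise-eval t τ unipolar = A₅-eval-at τ t (realise-literal t τ unipolar)

  realise-summand⇒occ : ∀ t τ x q → summand (literal A₅ (realise t τ) x q) ≡ just true → occ q x t
  realise-summand⇒occ t τ x true e with occ? true x t | occ? false x t
  ... | yes o | _     = o
  ... | no _  | yes _ with () ← trans (sym (summand-at false (not (τ x false)))) e
  ... | no _  | no _  with () ← e
  realise-summand⇒occ t τ x false e with occ? true x t | occ? false x t
  ... | yes _ | _     with () ← trans (sym (summand-∼at (τ x true))) e
  ... | no _  | yes o = o
  ... | no _  | no _  with () ← e

  A₅-unipolar-⊑ : ∀ φ ψ → Unipolar φ → A₅ ⊨ φ ≈ ψ → ψ ⊑ φ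
  A₅-unipolar-⊑ φ ψ unipolar valid q x o =
    realise-summand⇒occ φ τ x q (A₅-summand-literals ψ ψ-in-summand q x o)
    where
    τ : ℕ → Bool → Bool
    τ _ _ = true
    ψ-in-summand : summand (eval A₅ (realise φ τ) ψ) ≡ just true
    ψ-in-summand = trans (cong summand (trans (sym (valid _)) (realise-eval φ τ unipolar))) (summand-at true _)

  A₅-mixed : ∀ φ ψ → BipolarTerm φ → Unipolar ψ → ¬ (A₅ ⊨ φ ≈ ψ)
  A₅-mixed φ ψ bipolar unipolar valid = case summand-clash of λ ()
    where
    ρ = realise ψ (λ _ _ → true)
    summand-clash : just true ≡ nothing
    summand-clash = begin
      just true              ≡⟨ summand-at true _ ⟨
      summand (at true _)    ≡⟨ cong summand (realise-eval ψ (λ _ _ → true) unipolar) ⟨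
      summand (eval A₅ ρ ψ)  ≡⟨ cong summand (valid ρ) ⟨
      summand (eval A₅ ρ φ)  ≡⟨ cong summand (A₅-bipolar≡u φ bipolar) ⟩
      nothing                ∎

  A₅-literalValid : ∀ φ ψ → Unipolar φ → BalancedRegular φ ψ → A₅ ⊨ φ ≈ ψ → LiteralValid φ ψ
  A₅-literalValid φ ψ unipolar bal valid τ = begin
    evalNNF 𝟚 τ true φ                    ≡⟨ value-at true _ ⟨
    value (at true (evalNNF 𝟚 τ true φ))  ≡⟨ cong value (realise-eval φ τ unipolar) ⟨
    value (eval A₅ (realise φ τ) φ)       ≡⟨ cong value (valid (realise φ τ)) ⟩
    value (eval A₅ (realise φ τ) ψ)       ≡⟨ cong value (A₅-eval-at τ ψ ψ-literals) ⟩
    value (at true (evalNNF 𝟚 τ true ψ))  ≡⟨ value-at true _ ⟩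
    evalNNF 𝟚 τ true ψ                    ∎
    where
    ψ-literals = AllLiterals-⊑ φ ψ (proj₁ (to (balanced⇔⊑ φ ψ) bal)) (realise-literal φ τ unipolar)

  A₅-complete : ∀ φ ψ → A₅ ⊨ φ ≈ ψ → Bipolar φ ψ ⊎ (BalancedRegular φ ψ × LiteralValid φ ψ)
  A₅-complete φ ψ valid with bipolar? φ | bipolar? ψ
  ... | inj₁ bφ | inj₁ bψ = inj₁ (bφ , bψ)
  ... | inj₁ bφ | inj₂ uψ = ⊥-elim (A₅-mixed φ ψ bφ uψ valid)
  ... | inj₂ uφ | inj₁ bψ = ⊥-elim (A₅-mixed ψ φ bψ uφ (sym ∘ valid))
  ... | inj₂ uφ | inj₂ uψ = inj₂ (bal , A₅-literalValid φ ψ uφ bal valid)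
    where
    bal = from (balanced⇔⊑ φ ψ) (A₅-unipolar-⊑ φ ψ uφ valid , A₅-unipolar-⊑ ψ φ uψ (sym ∘ valid))

  BipolarOrBalancedDML : Term → Term → Set₁
  BipolarOrBalancedDML φ ψ = Bipolar φ ψ ⊎ (BalancedRegular φ ψ × Id DML φ ψ)

  A₅-⊨⇔ : ∀ φ ψ → A₅ ⊨ φ ≈ ψ ⇔ BipolarOrBalancedDML φ ψ
  A₅-⊨⇔ φ ψ = mk⇔
    (Sum.map₂ (λ (bal , valid) → bal , literalValid⇒DML φ ψ valid) ∘ A₅-complete φ ψ)
    [ (λ (bφ , bψ) ρ → trans (A₅-bipolar≡u φ bφ) (sym (A₅-bipolar≡u ψ bψ)))
    , (λ (bal , valid) → A₅-balanced-sound φ ψ bal (DML⇒literalValid φ ψ valid)) ]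

  -- The involutive semilattices IS₂ and IS₄

  point : {C : Set} → C → C → ℕ → ℕ → C
  point c d x y with y ≟ℕ x
  ... | yes _ = c
  ... | no _  = d

  point-at : ∀ {C} {c d : C} x → point c d x x ≡ c
  point-at x with x ≟ℕ x
  ... | yes _  = refl
  ... | no x≢x = ⊥-elim (x≢x refl)

  point-elsewhere : ∀ {C} {c d : C} x y → y ≢ x → point c d x y ≡ d
  point-elsewhere x y y≢x with y ≟ℕ x
  ... | yes y≡x = ⊥-elim (y≢x y≡x)
  ... | no _    = refl

  IS₂-deMorgan : DeMorganNegation IS₂
  IS₂-deMorgan = record { dneg = λ _ → refl ; dm-∧ = λ _ _ → refl ; dm-∨ = λ _ _ → refl }

  is2-join≡i : ∀ v w → is2-join v w ≡ i ⇔ (v ≡ i × w ≡ i)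
  is2-join≡i i w = mk⇔ (refl ,_) proj₂
  is2-join≡i j w = mk⇔ (λ ()) (λ { (() , _) })

  ≡i⇔⇒≡ : ∀ {v w : IS2C} → (v ≡ i ⇔ w ≡ i) → v ≡ w
  ≡i⇔⇒≡ {i} {i} _ = refl
  ≡i⇔⇒≡ {i} {j} e = sym (to e refl)
  ≡i⇔⇒≡ {j} {i} e = from e refl
  ≡i⇔⇒≡ {j} {j} _ = refl

  IS₂-eval≡i⇔ : ∀ ρ t → eval IS₂ ρ t ≡ i ⇔ (∀ x → Var t x → ρ x ≡ i)
  IS₂-eval≡i⇔ ρ t rewrite sym (evalNNF-eval IS₂-deMorgan ρ t) = mk⇔
    (λ h x → [ to (allLiterals⇔ t) (to bottom h) true x , to (allLiterals⇔ t) (to bottom h) false x ])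
    (λ f → from bottom (from (allLiterals⇔ t) λ { true x o → f x (inj₁ o) ; false x o → f x (inj₂ o) }))
    where
    bottom = evalNNF-all {IS₂} {literal IS₂ ρ} (_≡ i) (λ { true → is2-join≡i ; false → is2-join≡i }) true t

  IS₂-⊨⇔ : ∀ φ ψ → IS₂ ⊨ φ ≈ ψ ⇔ Regular φ ψ
  IS₂-⊨⇔ φ ψ = mk⇔
    (λ valid x → mk⇔ (variables⊆ φ ψ valid x) (variables⊆ ψ φ (sym ∘ valid) x))
    (λ regular ρ → ≡i⇔⇒≡ (mk⇔ (bottom⇒ ρ φ ψ (from ∘ regular)) (bottom⇒ ρ ψ φ (to ∘ regular))))
    where
    bottom⇒ : ∀ ρ φ ψ → (∀ x → Var ψ x → Var φ x) → eval IS₂ ρ φ ≡ i → eval IS₂ ρ ψ ≡ i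
    bottom⇒ ρ φ ψ ψ⊆φ h = from (IS₂-eval≡i⇔ ρ ψ) λ x v → to (IS₂-eval≡i⇔ ρ φ) h x (ψ⊆φ x v)
    variables⊆ : ∀ φ ψ → IS₂ ⊨ φ ≈ ψ → ∀ x → Var φ x → Var ψ x
    variables⊆ φ ψ valid x v with occ? true x ψ | occ? false x ψ
    ... | yes o  | _      = inj₁ o
    ... | no _   | yes o  = inj₂ o
    ... | no ¬o⁺ | no ¬o⁻ = case trans (sym (point-at x)) (to (IS₂-eval≡i⇔ ρ φ) φ-bottom x v) of λ ()
      where
      ρ : ℕ → IS2C
      ρ = point j i x
      φ-bottom : eval IS₂ ρ φ ≡ i
      φ-bottom = trans (valid ρ)
        (from (IS₂-eval≡i⇔ ρ ψ) λ y v → point-elsewhere x y λ { refl → [ ¬o⁺ , ¬o⁻ ] v })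

  IS4C-cases : {P : IS4C → Set} → P i → P j → P nj → P k → ∀ x → P x
  IS4C-cases pi pj pnj pk i  = pi
  IS4C-cases pi pj pnj pk j  = pj
  IS4C-cases pi pj pnj pk nj = pnj
  IS4C-cases pi pj pnj pk k  = pk

  is4-neg-join : ∀ x y → is4-neg (is4-join x y) ≡ is4-join (is4-neg x) (is4-neg y)
  is4-neg-join = IS4C-cases
    (IS4C-cases refl refl refl refl) (IS4C-cases refl refl refl refl)
    (IS4C-cases refl refl refl refl) (IS4C-cases refl refl refl refl)

  IS₄-deMorgan : DeMorganNegation IS₄
  IS₄-deMorgan = record { dneg = IS4C-cases refl refl refl refl ; dm-∧ = is4-neg-join ; dm-∨ = is4-neg-join }

  -- IS₄ is the join semilattice of subsets of {+, -}: i = ∅, j = {+}, nj = {-}, k = {+, -}.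
  has : Bool → IS4C → Bool
  has true  i  = false
  has true  j  = true
  has true  nj = false
  has true  k  = true
  has false i  = false
  has false j  = false
  has false nj = true
  has false k  = true

  has-join : ∀ q x y → has q (is4-join x y) ≡ has q x ∨ has q y
  has-join true = IS4C-cases
    (IS4C-cases refl refl refl refl) (IS4C-cases refl refl refl refl)
    (IS4C-cases refl refl refl refl) (IS4C-cases refl refl refl refl)
  has-join false = IS4C-cases
    (IS4C-cases refl refl refl refl) (IS4C-cases refl refl refl refl)
    (IS4C-cases refl refl refl refl) (IS4C-cases refl refl refl refl)

  has-injective : ∀ {v w} → (∀ q → has q v ≡ has q w) → v ≡ w
  has-injective {v} {w} h = begin
    v                                 ≡⟨ decode-has v ⟨
    decode (has true v) (has false v) ≡⟨ cong₂ decode (h true) (h false) ⟩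
    decode (has true w) (has false w) ≡⟨ decode-has w ⟩
    w                                 ∎
    where
    decode : Bool → Bool → IS4C
    decode false false = i
    decode true  false = j
    decode false true  = nj
    decode true  true  = k
    decode-has : ∀ v → decode (has true v) (has false v) ≡ v
    decode-has = IS4C-cases refl refl refl refl

  ≡false⇔⇒≡ : ∀ {b c} → (b ≡ false ⇔ c ≡ false) → b ≡ c
  ≡false⇔⇒≡ {true}  {true}  _ = refl
  ≡false⇔⇒≡ {true}  {false} e = from e refl
  ≡false⇔⇒≡ {false} {true}  e = sym (to e refl)
  ≡false⇔⇒≡ {false} {false} _ = refl

  is4-join-has≡false : ∀ q v w → has q (is4-join v w) ≡ false ⇔ (has q v ≡ false × has q w ≡ false)
  is4-join-has≡false q v w = mk⇔
    (λ e → let e′ = trans (sym (has-join q v w)) e in Boolₚ.∨-conicalˡ _ _ e′ , Boolₚ.∨-conicalʳ _ _ e′)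
    (λ (e₁ , e₂) → trans (has-join q v w) (cong₂ _∨_ e₁ e₂))

  IS₄-has≡false⇔ : ∀ q ρ t →
                   has q (eval IS₄ ρ t) ≡ false ⇔ (∀ r x → occ r x t → has q (literal IS₄ ρ x r) ≡ false)
  IS₄-has≡false⇔ q ρ t rewrite sym (evalNNF-eval IS₄-deMorgan ρ t) =
    mk⇔ (to (allLiterals⇔ t) ∘ to lacks) (from lacks ∘ from (allLiterals⇔ t))
    where
    lacks = evalNNF-all {IS₄} {literal IS₄ ρ} (λ v → has q v ≡ false)
                        (λ { true → is4-join-has≡false q ; false → is4-join-has≡false q }) true t

  has-point-at : ∀ q x → has q (literal IS₄ (point j i x) x q) ≡ true
  has-point-at q x with x ≟ℕ x
  has-point-at true  x | yes _  = refl
  has-point-at false x | yes _  = refl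
  has-point-at q     x | no x≢x = ⊥-elim (x≢x refl)

  has-point-other : ∀ q r x y → ¬ (y ≡ x × r ≡ q) → has q (literal IS₄ (point j i x) y r) ≡ false
  has-point-other q r x y ¬here with y ≟ℕ x
  has-point-other true  true  x y ¬here | yes y≡x = ⊥-elim (¬here (y≡x , refl))
  has-point-other false false x y ¬here | yes y≡x = ⊥-elim (¬here (y≡x , refl))
  has-point-other true  false x y ¬here | yes _   = refl
  has-point-other false true  x y ¬here | yes _   = refl
  has-point-other true  true  x y ¬here | no _    = refl
  has-point-other true  false x y ¬here | no _    = refl
  has-point-other false true  x y ¬here | no _    = refl
  has-point-other false false x y ¬here | no _    = refl

  IS₄-⊨⇔ : ∀ φ ψ → IS₄ ⊨ φ ≈ ψ ⇔ BalancedRegular φ ψ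
  IS₄-⊨⇔ φ ψ = mk⇔
    (λ valid → from (balanced⇔⊑ φ ψ) (occurrences⊑ ψ φ (sym ∘ valid) , occurrences⊑ φ ψ valid))
    (λ bal ρ → let ψ⊑φ , φ⊑ψ = to (balanced⇔⊑ φ ψ) bal in
      has-injective λ q → ≡false⇔⇒≡ (mk⇔ (lacks⇒ q ρ φ ψ ψ⊑φ) (lacks⇒ q ρ ψ φ φ⊑ψ)))
    where
    lacks⇒ : ∀ q ρ φ ψ → ψ ⊑ φ → has q (eval IS₄ ρ φ) ≡ false → has q (eval IS₄ ρ ψ) ≡ false
    lacks⇒ q ρ φ ψ ψ⊑φ h =
      from (IS₄-has≡false⇔ q ρ ψ) λ r x o → to (IS₄-has≡false⇔ q ρ φ) h r x (ψ⊑φ r x o)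
    occurrences⊑ : ∀ φ ψ → IS₄ ⊨ φ ≈ ψ → φ ⊑ ψ
    occurrences⊑ φ ψ valid q x o with occ? q x ψ
    ... | yes o′ = o′
    ... | no ¬o′ = case trans (sym (has-point-at q x)) (to (IS₄-has≡false⇔ q ρ φ) φ-lacks q x o) of λ ()
      where
      ρ : ℕ → IS4C
      ρ = point j i x
      φ-lacks : has q (eval IS₄ ρ φ) ≡ false
      φ-lacks = trans (cong (has q) (valid ρ)) (from (IS₄-has≡false⇔ q ρ ψ) λ r y o″ →
        has-point-other q r x y λ { (refl , refl) → ¬o′ o″ })

  -- The three varieties

  Mod≐V : ∀ {Σ : Identities} {K : Alg → Set₁} →
          (∀ φ ψ → Σ φ ψ → Id K φ ψ) → (∀ φ ψ → Id K φ ψ → Σ φ ψ) → Mod Σ ≐ V K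
  Mod≐V sound complete A = mk⇔ (λ m φ ψ → m φ ψ ∘ complete φ ψ) (λ v φ ψ → v φ ψ ∘ sound φ ψ)

  Id-⟦⟧ : ∀ B φ ψ → Id ⟦ B ⟧ φ ψ ⇔ B ⊨ φ ≈ ψ
  Id-⟦⟧ B φ ψ = mk⇔ (λ h → h B (lift refl)) (λ { h _ (lift refl) → h })

  Id-⟦,⟧ : ∀ B C φ ψ → Id (⟦_,_⟧ B C) φ ψ ⇔ (B ⊨ φ ≈ ψ × C ⊨ φ ≈ ψ)
  Id-⟦,⟧ B C φ ψ = mk⇔ (λ h → h B (lift (inj₁ refl)) , h C (lift (inj₂ refl)))
                       (λ { (hB , _) _ (lift (inj₁ refl)) → hB ; (_ , hC) _ (lift (inj₂ refl)) → hC })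

  bipolarOrBalancedDML : ∀ φ ψ → BipolarlyBalanced φ ψ → ValidOrBipolar DML φ ψ → BipolarOrBalancedDML φ ψ
  bipolarOrBalancedDML φ ψ (inj₁ bipolar) _                     = inj₁ bipolar
  bipolarOrBalancedDML φ ψ (inj₂ bal)     (inj₁ valid)          = inj₂ (bal , valid)
  bipolarOrBalancedDML φ ψ (inj₂ _)       (inj₂ (lift bipolar)) = inj₁ bipolar

  validOrBipolar : ∀ φ ψ → BipolarOrBalancedDML φ ψ → ValidOrBipolar DML φ ψ
  validOrBipolar φ ψ (inj₁ bipolar)     = inj₂ (lift bipolar)
  validOrBipolar φ ψ (inj₂ (_ , valid)) = inj₁ valid

  Bip⁻-DML≐V-A₅ : Bip⁻ DML ≐ V ⟦ A₅ ⟧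
  Bip⁻-DML≐V-A₅ = Mod≐V
    (λ φ ψ (lift bb , vb) → from (Id-⟦⟧ A₅ φ ψ) (from (A₅-⊨⇔ φ ψ) (bipolarOrBalancedDML φ ψ bb vb)))
    (λ φ ψ h → let c = to (A₅-⊨⇔ φ ψ) (to (Id-⟦⟧ A₅ φ ψ) h) in
      lift (Sum.map₂ proj₁ c) , validOrBipolar φ ψ c)

  RBip⁻-DML≐V-A₅-IS₂ : RBip⁻ DML ≐ V (⟦_,_⟧ A₅ IS₂)
  RBip⁻-DML≐V-A₅-IS₂ = Mod≐V
    (λ φ ψ (lift rbb , vb) → from (Id-⟦,⟧ A₅ IS₂ φ ψ)
      ( from (A₅-⊨⇔ φ ψ) (bipolarOrBalancedDML φ ψ (Sum.map₁ proj₁ rbb) vb)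
      , from (IS₂-⊨⇔ φ ψ) ([ proj₂ , balanced⇒regular {φ} {ψ} ]′ rbb)))
    (λ φ ψ h → let hA₅ , hIS₂ = to (Id-⟦,⟧ A₅ IS₂ φ ψ) h ; c = to (A₅-⊨⇔ φ ψ) hA₅ in
      lift (Sum.map (_, to (IS₂-⊨⇔ φ ψ) hIS₂) proj₁ c) , validOrBipolar φ ψ c)

  B⁻-DML≐V-A₅-IS₄ : B⁻ DML ≐ V (⟦_,_⟧ A₅ IS₄)
  B⁻-DML≐V-A₅-IS₄ = Mod≐V
    (λ φ ψ (lift bal , vb) → from (Id-⟦,⟧ A₅ IS₄ φ ψ)
      (from (A₅-⊨⇔ φ ψ) (bipolarOrBalancedDML φ ψ (inj₂ bal) vb) , from (IS₄-⊨⇔ φ ψ) bal))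
    (λ φ ψ h → let hA₅ , hIS₄ = to (Id-⟦,⟧ A₅ IS₄ φ ψ) h in
      lift (to (IS₄-⊨⇔ φ ψ) hIS₄) , validOrBipolar φ ψ (to (A₅-⊨⇔ φ ψ) hA₅))

open Proof using (Bip⁻-DML≐V-A₅; RBip⁻-DML≐V-A₅-IS₂; B⁻-DML≐V-A₅-IS₄)

theorem4p10 : (Bip⁻ DML ≐ V ⟦ A₅ ⟧) × (RBip⁻ DML ≐ V ⟦ A₅ , IS₂ ⟧) × (B⁻ DML ≐ V ⟦ A₅ , IS₄ ⟧)
theorem4p10 = Bip⁻-DML≐V-A₅ ,′ RBip⁻-DML≐V-A₅-IS₂ ,′ B⁻-DML≐V-A₅-IS₄
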